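{- Let $F$ be a finite simple graph and let $R$ be a set of pendant edges of $F$. Suppose the rooted graph $L(F)_R$ admits a valid decomposition $\mathcal{D}$, and there exist a simple graph $F'$ and an isomorphism $I(\mathcal{D})\cong L(F')$ under which each edge part of $\mathcal{D}$ corresponds to a pendant edge of $F'$. Then $F$ does not contain the diamond graph ($K_4$ minus an edge) as an induced subgraph.
   Context: $L(\cdot)$ denotes the line graph; $L(F)_R$ is $L(F)$ with root set $R$. A pendant edge is an edge with an endpoint of degree $1$. A valid decomposition of a rooted graph $G_R$ is a partition of $E(G)$ into parts each a triangle or a single edge (edge part), identified with vertex sets, such that every non-root vertex lies in exactly $3$ parts and every root in exactly $2$ parts. $I(\mathcal{D})$ is the graph on $\mathcal{D}$ in which two parts are adjacent iff they intersect. -}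

module Defs where

open import Data.Nat using (ℕ; zero; suc)
open import Data.Bool using (Bool; true; false; if_then_else_)
open import Data.Fin using (Fin; _<_)
open import Data.List using (map; allFin)
open import Data.Nat.ListAction using (sum)
open import Data.Product using (Σ; Σ-syntax; ∃; ∃-syntax; _×_; _,_; proj₁; proj₂)
open import Data.Sum using (_⊎_)
open import Relation.Binary.PropositionalEquality using (_≡_)
open import Relation.Nullary using (¬_)
open import Function.Bundles using (_↔_; Inverse)
open import Level using (0ℓ)

record FinGraph : Set where
  field
    n      : ℕ
    adj    : Fin n → Fin n → Bool
    symm   : ∀ u v → adj u v ≡ adj v u
    irrefl : ∀ u → adj u u ≡ false
open FinGraph public

deg : (F : FinGraph) → Fin (n F) → ℕ
deg F u = sum (map (λ w → if adj F u w then 1 else 0) (allFin (n F)))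

-- an (unordered) edge {u,v}, stored with u < v
Edge : FinGraph → Set
Edge F = Σ[ u ∈ Fin (n F) ] Σ[ v ∈ Fin (n F) ] (u < v × adj F u v ≡ true)

ends₁ ends₂ : (F : FinGraph) → Edge F → Fin (n F)
ends₁ F (u , _ , _) = u
ends₂ F (_ , v , _) = v

EndOf : (F : FinGraph) → Fin (n F) → Edge F → Set
EndOf F x e = x ≡ ends₁ F e ⊎ x ≡ ends₂ F e

Pendant : (F : FinGraph) → Edge F → Set
Pendant F e = deg F (ends₁ F e) ≡ 1 ⊎ deg F (ends₂ F e) ≡ 1

record Graph : Set₁ where
  field
    V   : Set
    Adj : V → V → Set
open Graph public

L : FinGraph → Graph
L F = record
  { V   = Edge F
  ; Adj = λ e e' → ¬ (e ≡ e') × (∃[ x ] (EndOf F x e × EndOf F x e'))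
  }

record Iso (G H : Graph) : Set where
  field
    φ       : V G ↔ V H
    pres    : ∀ x y → Adj G x y → Adj H (Inverse.to φ x) (Inverse.to φ y)
    refl'   : ∀ x y → Adj H (Inverse.to φ x) (Inverse.to φ y) → Adj G x y
open Iso public

HasSize : Set → ℕ → Set
HasSize A m = A ↔ Fin m

-- a part: a triangle or a single edge of G, identified with its vertex set
data Part (G : Graph) : Set where
  triangle : (a b c : V G) → Adj G a b → Adj G b c → Adj G a c → Part G
  edgePart : (a b : V G) → Adj G a b → Part G

_∈P_ : {G : Graph} → V G → Part G → Set
x ∈P triangle a b c _ _ _ = x ≡ a ⊎ x ≡ b ⊎ x ≡ c
x ∈P edgePart a b _       = x ≡ a ⊎ x ≡ b

IsEdgePart : {G : Graph} → Part G → Set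
IsEdgePart (triangle _ _ _ _ _ _) = Data.Empty.⊥ where import Data.Empty
IsEdgePart (edgePart _ _ _)       = Data.Unit.⊤ where import Data.Unit

record Decomposition (G : Graph) : Set where
  field
    k    : ℕ
    part : Fin k → Part G
open Decomposition public

record IsValid (G : Graph) (R : V G → Set) (D : Decomposition G) : Set where
  field
    partition : ∀ a b → Adj G a b →
                HasSize (Σ[ i ∈ Fin (k D) ] (a ∈P part D i × b ∈P part D i)) 1
    nonroot   : ∀ v → ¬ R v → HasSize (Σ[ i ∈ Fin (k D) ] (v ∈P part D i)) 3
    root      : ∀ v → R v → HasSize (Σ[ i ∈ Fin (k D) ] (v ∈P part D i)) 2

I : {G : Graph} → Decomposition G → Graph
I {G} D = record
  { V   = Fin (k D)
  ; Adj = λ i j → ¬ (i ≡ j) × (∃[ v ] (v ∈P part D i × v ∈P part D j))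
  }

HasInducedDiamond : FinGraph → Set
HasInducedDiamond F =
  Σ[ a ∈ Fin (n F) ] Σ[ b ∈ Fin (n F) ] Σ[ c ∈ Fin (n F) ] Σ[ d ∈ Fin (n F) ]
    ( ¬ (a ≡ d)
    × adj F a b ≡ true × adj F a c ≡ true × adj F b c ≡ true
    × adj F b d ≡ true × adj F c d ≡ true × adj F a d ≡ false )

{-# OPTIONS --safe #-}
-- The diamond a, b, c, d (ad being the missing edge) becomes in L(F) a wheel: the hub bc is
-- adjacent to the rim ab, ac, cd, bd, a 4-cycle whose opposite vertices are non-adjacent. Every
-- endpoint of these five edges has degree at least 2, so none of them is a root, roots being
-- pendant. Hence the hub lies in exactly three parts of D, each rim vertex shares one of them with
-- the hub, and opposite rim vertices never share a part. Up to the symmetries of the wheel this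
-- leaves three possibilities: two triangle parts {bc, ab, ac} and {bc, cd, bd}; two star parts
-- {bc, ab, bd} and {bc, ac, cd}; or a part holding the hub with two consecutive rim vertices while
-- the other two meet the hub in different parts. Each of them produces in I(D) a configuration
-- that no line graph contains, contradicting I(D) ≅ L(F').
module Submission where

open import Defs
open import Axiom.UniquenessOfIdentityProofs using (module Decidable⇒UIP)
open import Data.Bool using (Bool; true; false; if_then_else_)
import Data.Bool.Properties as Bool
open import Data.Empty using (⊥; ⊥-elim)
open import Data.Fin using (Fin; zero; suc; _<_)
open import Data.Fin.Properties using (_≟_; <-cmp; <-asym; <-irrelevant; pigeonhole)
open import Data.List using (List; []; _∷_; map)
open import Data.List.Membership.Propositional using () renaming (_∈_ to _∈ˡ_)
open import Data.List.Membership.Propositional.Properties using (∈-allFin)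
open import Data.List.Relation.Unary.Any using (here; there)
open import Data.Nat as ℕ using (ℕ; _+_; _≤_)
open import Data.Nat.ListAction using (sum)
open import Data.Nat.Properties using (m≤m+n; m≤n+m; ≤-trans; +-monoʳ-≤; +-comm; n<1+n; <-irrefl)
open import Data.Product using (Σ; Σ-syntax; _×_; _,_; proj₁; proj₂)
open import Data.Sum using (_⊎_; inj₁; inj₂; [_,_]′)
open import Data.Vec using ([]; _∷_; lookup)
open import Function.Base using (_∘_; id)
open import Function.Bundles using (Inverse; Injection)
open import Function.Properties.Inverse using (↔⇒↣)
open import Relation.Binary.Definitions using (DecidableEquality; tri<; tri≈; tri>)
open import Relation.Binary.PropositionalEquality
  using (_≡_; refl; sym; trans; subst; cong; cong₂; _≢_; ≢-sym)
open import Relation.Nullary using (¬_; Dec; yes; no)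

AtMostThree : {A : Set} → (A → Set) → Set
AtMostThree P = ∀ {a b c d} → P a → P b → P c → P d →
  a ≢ b → a ≢ c → a ≢ d → b ≢ c → b ≢ d → c ≢ d → ⊥

Fin3-avoid : (i j : Fin 3) → Σ[ l ∈ Fin 3 ] (l ≢ i × l ≢ j)
Fin3-avoid zero             zero             = suc zero , (λ ()) , (λ ())
Fin3-avoid zero             (suc zero)       = suc (suc zero) , (λ ()) , (λ ())
Fin3-avoid zero             (suc (suc zero)) = suc zero , (λ ()) , (λ ())
Fin3-avoid (suc zero)       zero             = suc (suc zero) , (λ ()) , (λ ())
Fin3-avoid (suc zero)       (suc zero)       = zero , (λ ()) , (λ ())
Fin3-avoid (suc zero)       (suc (suc zero)) = zero , (λ ()) , (λ ())
Fin3-avoid (suc (suc zero)) zero             = suc zero , (λ ()) , (λ ())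
Fin3-avoid (suc (suc zero)) (suc zero)       = zero , (λ ()) , (λ ())
Fin3-avoid (suc (suc zero)) (suc (suc zero)) = zero , (λ ()) , (λ ())

module _ {A : Set} {P : A → Set} where

  atMostThree-fromFin3 : (index : ∀ {a} → P a → Fin 3) →
    (∀ {a b} (pa : P a) (pb : P b) → index pa ≡ index pb → a ≡ b) → AtMostThree P
  atMostThree-fromFin3 index injective pa pb pc pd a≢b a≢c a≢d b≢c b≢d c≢d
    with pigeonhole (n<1+n 3) (lookup (index pa ∷ index pb ∷ index pc ∷ index pd ∷ []))
  ... | zero , suc zero , _ , eq = a≢b (injective pa pb eq)
  ... | zero , suc (suc zero) , _ , eq = a≢c (injective pa pc eq)
  ... | zero , suc (suc (suc zero)) , _ , eq = a≢d (injective pa pd eq)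
  ... | suc zero , suc (suc zero) , _ , eq = b≢c (injective pb pc eq)
  ... | suc zero , suc (suc (suc zero)) , _ , eq = b≢d (injective pb pd eq)
  ... | suc (suc zero) , suc (suc (suc zero)) , _ , eq = c≢d (injective pc pd eq)
  ... | zero , zero , () , _
  ... | suc _ , zero , () , _
  ... | suc zero , suc zero , ℕ.s≤s () , _
  ... | suc (suc _) , suc zero , ℕ.s≤s () , _
  ... | suc (suc zero) , suc (suc zero) , ℕ.s≤s (ℕ.s≤s ()) , _
  ... | suc (suc (suc _)) , suc (suc zero) , ℕ.s≤s (ℕ.s≤s ()) , _
  ... | suc (suc (suc zero)) , suc (suc (suc zero)) , ℕ.s≤s (ℕ.s≤s (ℕ.s≤s ())) , _

  atMostThree-cover : DecidableEquality A → AtMostThree P →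
    ∀ {a b c d} → P a → P b → P c → a ≢ b → a ≢ c → b ≢ c → P d → d ≡ a ⊎ d ≡ b ⊎ d ≡ c
  atMostThree-cover _≟ᴬ_ atMostThree {a} {b} {c} {d} pa pb pc a≢b a≢c b≢c pd
    with d ≟ᴬ a | d ≟ᴬ b | d ≟ᴬ c
  ... | yes d≡a | _       | _       = inj₁ d≡a
  ... | no _    | yes d≡b | _       = inj₂ (inj₁ d≡b)
  ... | no _    | no _    | yes d≡c = inj₂ (inj₂ d≡c)
  ... | no d≢a  | no d≢b  | no d≢c  =
    ⊥-elim (atMostThree pa pb pc pd a≢b a≢c (≢-sym d≢a) b≢c (≢-sym d≢b) (≢-sym d≢c))

  third-of-three : (∀ {a} (pa pa′ : P a) → pa ≡ pa′) → HasSize (Σ A P) 3 →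
    ∀ {a b} → P a → P b → Σ[ c ∈ A ] (P c × c ≢ a × c ≢ b)
  third-of-three irrelevant size {a} {b} pa pb =
    let l , l≢a , l≢b = Fin3-avoid (to (a , pa)) (to (b , pb))
    in proj₁ (from l) , proj₂ (from l) , avoids l≢a , avoids l≢b
    where
      open Inverse size
      avoids : ∀ {l c} {pc : P c} → l ≢ to (c , pc) → proj₁ (from l) ≢ c
      avoids {l} {pc = pc} l≢c refl =
        l≢c (trans (sym (strictlyInverseˡ l)) (cong (λ pc′ → to (_ , pc′)) (irrelevant _ pc)))

≤sum-map : {A : Set} (g : A → ℕ) {u : A} {xs : List A} → u ∈ˡ xs → g u ≤ sum (map g xs)
≤sum-map g {xs = x ∷ xs} (here refl) = m≤m+n (g x) (sum (map g xs))
≤sum-map g {xs = x ∷ xs} (there u∈xs) = ≤-trans (≤sum-map g u∈xs) (m≤n+m (sum (map g xs)) (g x))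

+≤sum-map : {A : Set} (g : A → ℕ) {u v : A} {xs : List A} → u ∈ˡ xs → v ∈ˡ xs → u ≢ v →
  g u + g v ≤ sum (map g xs)
+≤sum-map g (here refl) (here refl) u≢v = ⊥-elim (u≢v refl)
+≤sum-map g {u} (here refl) (there v∈xs) _ = +-monoʳ-≤ (g u) (≤sum-map g v∈xs)
+≤sum-map g {u} {v} {x ∷ _} (there u∈xs) (here refl) _
  rewrite +-comm (g u) (g x) = +-monoʳ-≤ (g x) (≤sum-map g u∈xs)
+≤sum-map g {xs = x ∷ xs} (there u∈xs) (there v∈xs) u≢v =
  ≤-trans (+≤sum-map g u∈xs v∈xs u≢v) (m≤n+m (sum (map g xs)) (g x))

-- Configurations excluded from line graphs

-- Arises from triangle parts X ⊇ {h, p, q} and Y ⊇ {h, r, s} of a wheel: Z is the third part at h,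
-- U the part of the rim edge sp, and U₂, U₃ are the third parts at p and at s.
record Wing (G : Graph) (X Y Z U : V G) : Set where
  field
    U₂ U₃  : V G
    U₂~X   : Adj G U₂ X
    U₂~U   : Adj G U₂ U
    U₂≁Y   : ¬ Adj G U₂ Y
    U₂≢Y   : U₂ ≢ Y
    U₃~U   : Adj G U₃ U
    U₃≁X   : ¬ Adj G U₃ X
    U₃≢X   : U₃ ≢ X
    closes : Adj G U₂ U₃ → Adj G Z U₂

record LineGraphLike (G : Graph) : Set where
  field
    commonNeighbours-noIndependentTriple : ∀ {X Y A B C} → Adj G X Y →
      Adj G A X → Adj G A Y → Adj G B X → Adj G B Y → Adj G C X → Adj G C Y →
      A ≢ B → A ≢ C → B ≢ C → ¬ Adj G A B → ¬ Adj G A C → ¬ Adj G B C → ⊥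
    commonNeighbours-complementaryPair : ∀ {X W Y Z S T} → X ≢ W → ¬ Adj G X W →
      Adj G Y X → Adj G Y W → Adj G Z X → Adj G Z W →
      Adj G S X → Adj G S W → Adj G T X → Adj G T W →
      Y ≢ Z → Y ≢ S → Y ≢ T → Z ≢ S → Z ≢ T → S ≢ T → ¬ Adj G S T → ¬ Adj G Y Z
    noTwoWings : ∀ {X Y P Q Z} → Adj G X Y →
      Adj G P X → Adj G P Y → Adj G Q X → Adj G Q Y → P ≢ Q → ¬ Adj G P Q →
      Adj G Z X → Adj G Z Y → Z ≢ P → Z ≢ Q → Wing G X Y Z P → Wing G X Y Z Q → ⊥

module _ {G H : Graph} (ψ : Iso G H) where
  private
    f : V G → V H
    f = Inverse.to (φ ψ)

    adj⁺ : ∀ {x y} → Adj G x y → Adj H (f x) (f y)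
    adj⁺ = pres ψ _ _

    nonadj⁺ : ∀ {x y} → ¬ Adj G x y → ¬ Adj H (f x) (f y)
    nonadj⁺ x≁y = x≁y ∘ refl' ψ _ _

    ≢⁺ : ∀ {x y} → x ≢ y → f x ≢ f y
    ≢⁺ x≢y fx≡fy = x≢y (Injection.injective (↔⇒↣ (φ ψ)) fx≡fy)

  Wing-transport : ∀ {X Y Z U} → Wing G X Y Z U → Wing H (f X) (f Y) (f Z) (f U)
  Wing-transport w = record
    { U₂ = f U₂ ; U₃ = f U₃
    ; U₂~X = adj⁺ U₂~X ; U₂~U = adj⁺ U₂~U ; U₂≁Y = nonadj⁺ U₂≁Y ; U₂≢Y = ≢⁺ U₂≢Y
    ; U₃~U = adj⁺ U₃~U ; U₃≁X = nonadj⁺ U₃≁X ; U₃≢X = ≢⁺ U₃≢X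
    ; closes = adj⁺ ∘ closes ∘ refl' ψ _ _
    }
    where open Wing w

  LineGraphLike-transport : LineGraphLike H → LineGraphLike G
  LineGraphLike-transport lg = record
    { commonNeighbours-noIndependentTriple =
        λ X~Y A~X A~Y B~X B~Y C~X C~Y A≢B A≢C B≢C A≁B A≁C B≁C →
          commonNeighbours-noIndependentTriple (adj⁺ X~Y)
            (adj⁺ A~X) (adj⁺ A~Y) (adj⁺ B~X) (adj⁺ B~Y) (adj⁺ C~X) (adj⁺ C~Y)
            (≢⁺ A≢B) (≢⁺ A≢C) (≢⁺ B≢C) (nonadj⁺ A≁B) (nonadj⁺ A≁C) (nonadj⁺ B≁C)
    ; commonNeighbours-complementaryPair =
        λ X≢W X≁W Y~X Y~W Z~X Z~W S~X S~W T~X T~W Y≢Z Y≢S Y≢T Z≢S Z≢T S≢T S≁T →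
          commonNeighbours-complementaryPair (≢⁺ X≢W) (nonadj⁺ X≁W)
            (adj⁺ Y~X) (adj⁺ Y~W) (adj⁺ Z~X) (adj⁺ Z~W)
            (adj⁺ S~X) (adj⁺ S~W) (adj⁺ T~X) (adj⁺ T~W)
            (≢⁺ Y≢Z) (≢⁺ Y≢S) (≢⁺ Y≢T) (≢⁺ Z≢S) (≢⁺ Z≢T) (≢⁺ S≢T) (nonadj⁺ S≁T) ∘ adj⁺
    ; noTwoWings =
        λ X~Y P~X P~Y Q~X Q~Y P≢Q P≁Q Z~X Z~Y Z≢P Z≢Q wP wQ →
          noTwoWings (adj⁺ X~Y) (adj⁺ P~X) (adj⁺ P~Y) (adj⁺ Q~X) (adj⁺ Q~Y)
            (≢⁺ P≢Q) (nonadj⁺ P≁Q) (adj⁺ Z~X) (adj⁺ Z~Y) (≢⁺ Z≢P) (≢⁺ Z≢Q)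
            (Wing-transport wP) (Wing-transport wQ)
    }
    where open LineGraphLike lg

-- Line graphs

module LineGraph (G : FinGraph) where

  infix 4 _~_ _∋_ _∋?_ _≟ᴱ_

  _~_ : Edge G → Edge G → Set
  _~_ = Adj (L G)

  -- A record rather than EndOf itself, so that the edge and the vertex can be inferred from it.
  record _∋_ (e : Edge G) (x : Fin (n G)) : Set where
    constructor ⌊_⌋
    field endOf : EndOf G x e

  false⇒¬adj : ∀ {x y} → adj G x y ≡ false → adj G x y ≢ true
  false⇒¬adj xy≡false xy≡true with trans (sym xy≡true) xy≡false
  ... | ()

  adj⇒≢ : ∀ {x y} → adj G x y ≡ true → x ≢ y
  adj⇒≢ {x} xy refl = false⇒¬adj (irrefl G x) xy

  adj-sym : ∀ {x y} → adj G x y ≡ true → adj G y x ≡ true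
  adj-sym {x} {y} xy = trans (symm G y x) xy

  ends₁<ends₂ : (e : Edge G) → ends₁ G e < ends₂ G e
  ends₁<ends₂ (_ , _ , u<v , _) = u<v

  Edge-≡ : (e e′ : Edge G) → ends₁ G e ≡ ends₁ G e′ → ends₂ G e ≡ ends₂ G e′ → e ≡ e′
  Edge-≡ (u , v , u<v , uv) (.u , .v , u<v′ , uv′) refl refl
    rewrite <-irrelevant u<v u<v′ | Decidable⇒UIP.≡-irrelevant Bool._≟_ uv uv′ = refl

  _≟ᴱ_ : DecidableEquality (Edge G)
  e ≟ᴱ e′ with ends₁ G e ≟ ends₁ G e′ | ends₂ G e ≟ ends₂ G e′
  ... | yes ≡₁ | yes ≡₂ = yes (Edge-≡ e e′ ≡₁ ≡₂)
  ... | no ≢₁  | _      = no λ e≡e′ → ≢₁ (cong (ends₁ G) e≡e′)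
  ... | _      | no ≢₂  = no λ e≡e′ → ≢₂ (cong (ends₂ G) e≡e′)

  _∋?_ : (e : Edge G) (x : Fin (n G)) → Dec (e ∋ x)
  e ∋? x with x ≟ ends₁ G e | x ≟ ends₂ G e
  ... | yes x≡₁ | _       = yes ⌊ inj₁ x≡₁ ⌋
  ... | no _    | yes x≡₂ = yes ⌊ inj₂ x≡₂ ⌋
  ... | no x≢₁  | no x≢₂  = no λ { ⌊ inj₁ x≡₁ ⌋ → x≢₁ x≡₁ ; ⌊ inj₂ x≡₂ ⌋ → x≢₂ x≡₂ }

  ∋-endpoints : ∀ {e x y v} → e ∋ x → e ∋ y → x ≢ y → e ∋ v → v ≡ x ⊎ v ≡ y
  ∋-endpoints ⌊ inj₁ refl ⌋ ⌊ inj₁ refl ⌋ x≢y _             = ⊥-elim (x≢y refl)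
  ∋-endpoints ⌊ inj₁ refl ⌋ ⌊ inj₂ refl ⌋ _   ⌊ inj₁ refl ⌋ = inj₁ refl
  ∋-endpoints ⌊ inj₁ refl ⌋ ⌊ inj₂ refl ⌋ _   ⌊ inj₂ refl ⌋ = inj₂ refl
  ∋-endpoints ⌊ inj₂ refl ⌋ ⌊ inj₁ refl ⌋ _   ⌊ inj₁ refl ⌋ = inj₂ refl
  ∋-endpoints ⌊ inj₂ refl ⌋ ⌊ inj₁ refl ⌋ _   ⌊ inj₂ refl ⌋ = inj₁ refl
  ∋-endpoints ⌊ inj₂ refl ⌋ ⌊ inj₂ refl ⌋ x≢y _             = ⊥-elim (x≢y refl)

  ∋⇒adj : ∀ {e x y} → e ∋ x → e ∋ y → x ≢ y → adj G x y ≡ true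
  ∋⇒adj ⌊ inj₁ refl ⌋ ⌊ inj₁ refl ⌋ x≢y = ⊥-elim (x≢y refl)
  ∋⇒adj {u , v , _ , uv} ⌊ inj₁ refl ⌋ ⌊ inj₂ refl ⌋ _ = uv
  ∋⇒adj {u , v , _ , uv} ⌊ inj₂ refl ⌋ ⌊ inj₁ refl ⌋ _ = adj-sym uv
  ∋⇒adj ⌊ inj₂ refl ⌋ ⌊ inj₂ refl ⌋ x≢y = ⊥-elim (x≢y refl)

  ∋-orientation : ∀ {e x y} → e ∋ x → e ∋ y → x ≢ y →
    (ends₁ G e ≡ x × ends₂ G e ≡ y) ⊎ (ends₁ G e ≡ y × ends₂ G e ≡ x)
  ∋-orientation ⌊ inj₁ refl ⌋ ⌊ inj₂ refl ⌋ _   = inj₁ (refl , refl)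
  ∋-orientation ⌊ inj₂ refl ⌋ ⌊ inj₁ refl ⌋ _   = inj₂ (refl , refl)
  ∋-orientation ⌊ inj₁ refl ⌋ ⌊ inj₁ refl ⌋ x≢y = ⊥-elim (x≢y refl)
  ∋-orientation ⌊ inj₂ refl ⌋ ⌊ inj₂ refl ⌋ x≢y = ⊥-elim (x≢y refl)

  edge-unique : ∀ {e e′ x y} → e ∋ x → e ∋ y → e′ ∋ x → e′ ∋ y → x ≢ y → e ≡ e′
  edge-unique {e} {e′} ex ey e′x e′y x≢y with ∋-orientation ex ey x≢y | ∋-orientation e′x e′y x≢y
  ... | inj₁ (refl , refl) | inj₁ (≡₁ , ≡₂)     = Edge-≡ e e′ (sym ≡₁) (sym ≡₂)
  ... | inj₂ (refl , refl) | inj₂ (≡₁ , ≡₂)     = Edge-≡ e e′ (sym ≡₁) (sym ≡₂)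
  ... | inj₁ (refl , refl) | inj₂ (refl , refl) = ⊥-elim (<-asym (ends₁<ends₂ e) (ends₁<ends₂ e′))
  ... | inj₂ (refl , refl) | inj₁ (refl , refl) = ⊥-elim (<-asym (ends₁<ends₂ e) (ends₁<ends₂ e′))

  edgeOf : ∀ {x y} → adj G x y ≡ true → Σ[ e ∈ Edge G ] (e ∋ x × e ∋ y)
  edgeOf {x} {y} xy with <-cmp x y
  ... | tri< x<y _ _ = (x , y , x<y , xy) , ⌊ inj₁ refl ⌋ , ⌊ inj₂ refl ⌋
  ... | tri≈ _ x≡y _ = ⊥-elim (adj⇒≢ xy x≡y)
  ... | tri> _ _ y<x = (y , x , y<x , adj-sym xy) , ⌊ inj₂ refl ⌋ , ⌊ inj₁ refl ⌋

  shared⇒~ : ∀ {e e′ x} → e ≢ e′ → e ∋ x → e′ ∋ x → e ~ e′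
  shared⇒~ e≢e′ ⌊ ex ⌋ ⌊ e′x ⌋ = e≢e′ , _ , ex , e′x

  ~⇒shared : ∀ {e e′} → e ~ e′ → Σ[ x ∈ Fin (n G) ] (e ∋ x × e′ ∋ x)
  ~⇒shared (_ , x , ex , e′x) = x , ⌊ ex ⌋ , ⌊ e′x ⌋

  ~⇒≢ : ∀ {e e′} → e ~ e′ → e ≢ e′
  ~⇒≢ = proj₁

  ~-sym : ∀ {e e′} → e ~ e′ → e′ ~ e
  ~-sym (e≢e′ , x , ex , e′x) = ≢-sym e≢e′ , x , e′x , ex

  ∋∌⇒≢ : ∀ {e x y} → e ∋ x → ¬ e ∋ y → x ≢ y
  ∋∌⇒≢ ex e∌y refl = e∌y ex

  ∌-pair : ∀ {e x y z} → e ∋ y → e ∋ z → y ≢ z → x ≢ y → x ≢ z → ¬ e ∋ x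
  ∌-pair ey ez y≢z x≢y x≢z ex = [ x≢y , x≢z ]′ (∋-endpoints ey ez y≢z ex)

  ∋∌⇒≢ᴱ : ∀ {e e′ x} → e ∋ x → ¬ e′ ∋ x → e ≢ e′
  ∋∌⇒≢ᴱ ex e′∌x refl = e′∌x ex

  apart⇒≁ : ∀ {e e′ x y} → e ∋ x → e ∋ y → x ≢ y → ¬ e′ ∋ x → ¬ e′ ∋ y → ¬ e ~ e′
  apart⇒≁ ex ey x≢y e′∌x e′∌y e~e′ =
    let v , ev , e′v = ~⇒shared e~e′
    in [ (λ { refl → e′∌x e′v }) , (λ { refl → e′∌y e′v }) ]′ (∋-endpoints ex ey x≢y ev)

  ∋-near : ∀ {e t x} → e ∋ x → t ∋ x → t ≡ e ⊎ t ~ e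
  ∋-near {e} {t} ex tx with t ≟ᴱ e
  ... | yes t≡e = inj₁ t≡e
  ... | no t≢e = inj₂ (shared⇒~ t≢e tx ex)

  avoiding-neighbours-meet : ∀ {B T U o} → B ∋ o → T ~ B → U ~ B → ¬ T ∋ o → ¬ U ∋ o →
    Σ[ x ∈ Fin (n G) ] (T ∋ x × U ∋ x × B ∋ x)
  avoiding-neighbours-meet Bo T~B U~B T∌o U∌o with ~⇒shared T~B | ~⇒shared U~B
  ... | t , Tt , Bt | _ , Uu , Bu with ∋-endpoints Bo Bt (≢-sym (∋∌⇒≢ Tt T∌o)) Bu
  ... | inj₁ refl = ⊥-elim (U∌o Uu)
  ... | inj₂ refl = t , Tt , Uu , Bt

  avoiding-commonNeighbour-unique : ∀ {X Y U U′ o} → X ∋ o → Y ∋ o → X ≢ Y →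
    U ~ X → U ~ Y → U′ ~ X → U′ ~ Y → ¬ U ∋ o → ¬ U′ ∋ o → U ≡ U′
  avoiding-commonNeighbour-unique Xo Yo X≢Y U~X U~Y U′~X U′~Y U∌o U′∌o
    with avoiding-neighbours-meet Xo U~X U′~X U∌o U′∌o
       | avoiding-neighbours-meet Yo U~Y U′~Y U∌o U′∌o
  ... | x , Ux , U′x , Xx | y , Uy , U′y , Yy = edge-unique Ux Uy U′x U′y x≢y
    where
      x≢y : x ≢ y
      x≢y refl = X≢Y (edge-unique Xo Xx Yo Yy (≢-sym (∋∌⇒≢ Ux U∌o)))

  avoiding-meetsAtMostTwo : ∀ {T A B C o} → A ∋ o → B ∋ o → C ∋ o →
    A ≢ B → A ≢ C → B ≢ C → ¬ T ∋ o → T ~ A → T ~ B → T ~ C → ⊥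
  avoiding-meetsAtMostTwo Ao Bo Co A≢B A≢C B≢C T∌o T~A T~B T~C
    with ~⇒shared T~A | ~⇒shared T~B | ~⇒shared T~C
  ... | a , Ta , Aa | b , Tb , Bb | c , Tc , Cc with a ≟ b
  ... | yes refl = A≢B (edge-unique Ao Aa Bo Bb (≢-sym (∋∌⇒≢ Ta T∌o)))
  ... | no a≢b with ∋-endpoints Ta Tb a≢b Tc
  ...   | inj₁ refl = A≢C (edge-unique Ao Aa Co Cc (≢-sym (∋∌⇒≢ Ta T∌o)))
  ...   | inj₂ refl = B≢C (edge-unique Bo Bb Co Cc (≢-sym (∋∌⇒≢ Tb T∌o)))

  nonadjacent-neighbours-cover : ∀ {X S T v} → X ∋ v → S ~ X → T ~ X → S ≢ T → ¬ S ~ T →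
    S ∋ v ⊎ T ∋ v
  nonadjacent-neighbours-cover Xv S~X T~X S≢T S≁T with ~⇒shared S~X | ~⇒shared T~X
  ... | s , Ss , Xs | t , Tt , Xt with s ≟ t
  ... | yes refl = ⊥-elim (S≁T (shared⇒~ S≢T Ss Tt))
  ... | no s≢t with ∋-endpoints Xs Xt s≢t Xv
  ...   | inj₁ refl = inj₁ Ss
  ...   | inj₂ refl = inj₂ Tt

  neighbour-of-apart-pair : ∀ {X W Y v} → X ≢ W → ¬ X ~ W → Y ~ X → Y ~ W → Y ∋ v →
    X ∋ v ⊎ W ∋ v
  neighbour-of-apart-pair X≢W X≁W Y~X Y~W Yv with ~⇒shared Y~X | ~⇒shared Y~W
  ... | x , Yx , Xx | w , Yw , Ww with x ≟ w
  ... | yes refl = ⊥-elim (X≁W (shared⇒~ X≢W Xx Ww))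
  ... | no x≢w with ∋-endpoints Yx Yw x≢w Yv
  ...   | inj₁ refl = inj₁ Xx
  ...   | inj₂ refl = inj₂ Ww

  commonNeighbours-noIndependentTriple : ∀ {X Y A B C} → X ~ Y →
    A ~ X → A ~ Y → B ~ X → B ~ Y → C ~ X → C ~ Y →
    A ≢ B → A ≢ C → B ≢ C → ¬ A ~ B → ¬ A ~ C → ¬ B ~ C → ⊥
  commonNeighbours-noIndependentTriple {A = A} {B} {C} X~Y A~X A~Y B~X B~Y C~X C~Y
    A≢B A≢C B≢C A≁B A≁C B≁C with ~⇒shared X~Y
  ... | o , Xo , Yo with A ∋? o | B ∋? o | C ∋? o
  ... | yes Ao | yes Bo | _      = A≁B (shared⇒~ A≢B Ao Bo)
  ... | yes Ao | no _   | yes Co = A≁C (shared⇒~ A≢C Ao Co)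
  ... | no _   | yes Bo | yes Co = B≁C (shared⇒~ B≢C Bo Co)
  ... | no A∌o | no B∌o | _      =
    A≢B (avoiding-commonNeighbour-unique Xo Yo (~⇒≢ X~Y) A~X A~Y B~X B~Y A∌o B∌o)
  ... | no A∌o | _      | no C∌o =
    A≢C (avoiding-commonNeighbour-unique Xo Yo (~⇒≢ X~Y) A~X A~Y C~X C~Y A∌o C∌o)
  ... | _      | no B∌o | no C∌o =
    B≢C (avoiding-commonNeighbour-unique Xo Yo (~⇒≢ X~Y) B~X B~Y C~X C~Y B∌o C∌o)

  commonNeighbours-complementaryPair : ∀ {X W Y Z S T} → X ≢ W → ¬ X ~ W →
    Y ~ X → Y ~ W → Z ~ X → Z ~ W → S ~ X → S ~ W → T ~ X → T ~ W →
    Y ≢ Z → Y ≢ S → Y ≢ T → Z ≢ S → Z ≢ T → S ≢ T → ¬ S ~ T → ¬ Y ~ Z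
  commonNeighbours-complementaryPair {Y = Y} {Z} {S} {T} X≢W X≁W Y~X Y~W Z~X Z~W S~X S~W T~X T~W
    Y≢Z Y≢S Y≢T Z≢S Z≢T S≢T S≁T Y~Z =
    let v , Yv , Zv = ~⇒shared Y~Z in
    [ (λ Xv → through Yv Zv Xv (λ Wv → X≁W (shared⇒~ X≢W Xv Wv)) S~X T~X
                (~-sym Y~W) (~-sym Z~W) (~-sym S~W) (~-sym T~W))
    , (λ Wv → through Yv Zv Wv (λ Xv → X≁W (shared⇒~ X≢W Xv Wv)) S~W T~W
                (~-sym Y~X) (~-sym Z~X) (~-sym S~X) (~-sym T~X))
    ]′ (neighbour-of-apart-pair X≢W X≁W Y~X Y~W Yv)
    where
      through : ∀ {X′ W′ v} → Y ∋ v → Z ∋ v → X′ ∋ v → ¬ W′ ∋ v → S ~ X′ → T ~ X′ →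
        W′ ~ Y → W′ ~ Z → W′ ~ S → W′ ~ T → ⊥
      through Yv Zv X′v W′∌v S~X′ T~X′ W′~Y W′~Z W′~S W′~T
        with nonadjacent-neighbours-cover X′v S~X′ T~X′ S≢T S≁T
      ... | inj₁ Sv = avoiding-meetsAtMostTwo Yv Zv Sv Y≢Z Y≢S Z≢S W′∌v W′~Y W′~Z W′~S
      ... | inj₂ Tv = avoiding-meetsAtMostTwo Yv Zv Tv Y≢Z Y≢T Z≢T W′∌v W′~Y W′~Z W′~T

  -- U₂ and U₃ avoid o, so both meet U at its other endpoint; but U₂, avoiding o, meets at most two
  -- of the edges X, U, Z through o.
  wing-throughSharedVertex : ∀ {X Y Z U o} → X ∋ o → Y ∋ o → U ∋ o → Z ∋ o →
    U ~ X → Z ~ X → Z ≢ U → Wing (L G) X Y Z U → ⊥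
  wing-throughSharedVertex {o = o} Xo Yo Uo Zo U~X Z~X Z≢U w =
    avoiding-meetsAtMostTwo Xo Uo Zo (≢-sym (~⇒≢ U~X)) (≢-sym (~⇒≢ Z~X)) (≢-sym Z≢U)
      U₂∌o U₂~X U₂~U (~-sym (closes U₂~U₃))
    where
      open Wing w
      U₂∌o : ¬ U₂ ∋ o
      U₂∌o U₂o = U₂≁Y (shared⇒~ U₂≢Y U₂o Yo)
      U₃∌o : ¬ U₃ ∋ o
      U₃∌o U₃o = U₃≁X (shared⇒~ U₃≢X U₃o Xo)
      U₂~U₃ : U₂ ~ U₃
      U₂~U₃ =
        let x , U₂x , U₃x , _ = avoiding-neighbours-meet Uo U₂~U U₃~U U₂∌o U₃∌o
        in shared⇒~ (λ { refl → U₃≁X U₂~X }) U₂x U₃x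

  noTwoWings : ∀ {X Y P Q Z} → X ~ Y → P ~ X → P ~ Y → Q ~ X → Q ~ Y → P ≢ Q → ¬ P ~ Q →
    Z ~ X → Z ~ Y → Z ≢ P → Z ≢ Q → Wing (L G) X Y Z P → Wing (L G) X Y Z Q → ⊥
  noTwoWings {P = P} {Q} {Z} X~Y P~X P~Y Q~X Q~Y P≢Q P≁Q Z~X Z~Y Z≢P Z≢Q wP wQ
    with ~⇒shared X~Y
  ... | o , Xo , Yo with P ∋? o | Q ∋? o | Z ∋? o
  ... | yes Po | yes Qo | _ = P≁Q (shared⇒~ P≢Q Po Qo)
  ... | no P∌o | no Q∌o | _ =
    P≢Q (avoiding-commonNeighbour-unique Xo Yo (~⇒≢ X~Y) P~X P~Y Q~X Q~Y P∌o Q∌o)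
  ... | yes _  | no Q∌o | no Z∌o =
    Z≢Q (avoiding-commonNeighbour-unique Xo Yo (~⇒≢ X~Y) Z~X Z~Y Q~X Q~Y Z∌o Q∌o)
  ... | no P∌o | yes _  | no Z∌o =
    Z≢P (avoiding-commonNeighbour-unique Xo Yo (~⇒≢ X~Y) Z~X Z~Y P~X P~Y Z∌o P∌o)
  ... | yes Po | no _   | yes Zo = wing-throughSharedVertex Xo Yo Po Zo P~X Z~X Z≢P wP
  ... | no _   | yes Qo | yes Zo = wing-throughSharedVertex Xo Yo Qo Zo Q~X Z~X Z≢Q wQ

  lineGraphLike : LineGraphLike (L G)
  lineGraphLike = record
    { commonNeighbours-noIndependentTriple = commonNeighbours-noIndependentTriple
    ; commonNeighbours-complementaryPair = commonNeighbours-complementaryPair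
    ; noTwoWings = noTwoWings
    }

  NoCommonNeighbour : Edge G → Edge G → Edge G → Set
  NoCommonNeighbour e e′ e″ = ∀ {t} → t ~ e → t ~ e′ → t ~ e″ → ⊥

  CommonNeighboursNear : Edge G → Edge G → Edge G → Set
  CommonNeighboursNear h e e′ = ∀ {t} → t ~ e → t ~ e′ → t ≡ h ⊎ t ~ h

  triangle-noCommonNeighbour : ∀ {h e e′ x y z} → h ∋ y → h ∋ z → e ∋ x → e ∋ y → e′ ∋ x → e′ ∋ z →
    x ≢ y → x ≢ z → y ≢ z → NoCommonNeighbour h e e′
  triangle-noCommonNeighbour hy hz ex ey e′x e′z x≢y x≢z y≢z t~h t~e t~e′
    with ~⇒shared t~h | ~⇒shared t~e | ~⇒shared t~e′
  ... | _ , tv₁ , hv₁ | _ , tv₂ , ev₂ | _ , tv₃ , e′v₃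
    with ∋-endpoints hy hz y≢z hv₁ | ∋-endpoints ex ey x≢y ev₂ | ∋-endpoints e′x e′z x≢z e′v₃
  ... | inj₁ refl | inj₁ refl | _         = ~⇒≢ t~e (edge-unique tv₂ tv₁ ex ey x≢y)
  ... | inj₁ refl | inj₂ refl | inj₁ refl = ~⇒≢ t~e (edge-unique tv₃ tv₁ ex ey x≢y)
  ... | inj₁ refl | inj₂ refl | inj₂ refl = ~⇒≢ t~h (edge-unique tv₁ tv₃ hy hz y≢z)
  ... | inj₂ refl | inj₁ refl | _         = ~⇒≢ t~e′ (edge-unique tv₂ tv₁ e′x e′z x≢z)
  ... | inj₂ refl | inj₂ refl | _         = ~⇒≢ t~h (edge-unique tv₂ tv₁ hy hz y≢z)

  star-commonNeighboursNear : ∀ {h e e′ b x y} → h ∋ b → e ∋ b → e ∋ x → e′ ∋ b → e′ ∋ y →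
    b ≢ x → b ≢ y → x ≢ y → adj G x y ≡ false → CommonNeighboursNear h e e′
  star-commonNeighboursNear hb eb ex e′b e′y b≢x b≢y x≢y xy t~e t~e′
    with ~⇒shared t~e | ~⇒shared t~e′
  ... | _ , tv , ev | _ , tw , e′w with ∋-endpoints eb ex b≢x ev | ∋-endpoints e′b e′y b≢y e′w
  ... | inj₁ refl | _         = ∋-near hb tv
  ... | inj₂ refl | inj₁ refl = ∋-near hb tw
  ... | inj₂ refl | inj₂ refl = ⊥-elim (false⇒¬adj xy (∋⇒adj tv tw x≢y))

  deg≢1 : ∀ {x u v} → adj G x u ≡ true → adj G x v ≡ true → u ≢ v → deg G x ≢ 1
  deg≢1 {x} {u} {v} xu xv u≢v deg≡1 = <-irrefl refl (subst (2 ≤_) deg≡1 2≤deg)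
    where
      indicator : Bool → ℕ
      indicator b = if b then 1 else 0
      2≤deg : 2 ≤ deg G x
      2≤deg = subst (_≤ deg G x) (cong₂ _+_ (cong indicator xu) (cong indicator xv))
        (+≤sum-map (indicator ∘ adj G x) (∈-allFin u) (∈-allFin v) u≢v)

  ¬Pendant : ∀ {e x y} → e ∋ x → e ∋ y → x ≢ y → deg G x ≢ 1 → deg G y ≢ 1 → ¬ Pendant G e
  ¬Pendant {e} ex ey x≢y x≢1 y≢1 = [ end (inj₁ refl) , end (inj₂ refl) ]′
    where
      end : ∀ {v} → EndOf G v e → deg G v ≢ 1
      end ev = [ (λ { refl → x≢1 }) , (λ { refl → y≢1 }) ]′ (∋-endpoints ex ey x≢y ⌊ ev ⌋)

  record Wheel (h p q r s : Edge G) : Set where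
    field
      h~p : h ~ p
      h~q : h ~ q
      h~r : h ~ r
      h~s : h ~ s
      p~q : p ~ q
      q~r : q ~ r
      r~s : r ~ s
      s~p : s ~ p
      p≁r : ¬ p ~ r
      q≁s : ¬ q ~ s
      p≢r : p ≢ r
      q≢s : q ≢ s
      hub-unique : ∀ {t} → t ~ p → t ~ q → t ~ r → t ~ s → t ≡ h

  rotate : ∀ {h p q r s} → Wheel h p q r s → Wheel h q r s p
  rotate w = record
    { h~p = h~q ; h~q = h~r ; h~r = h~s ; h~s = h~p
    ; p~q = q~r ; q~r = r~s ; r~s = s~p ; s~p = p~q
    ; p≁r = q≁s ; q≁s = p≁r ∘ ~-sym ; p≢r = q≢s ; q≢s = ≢-sym p≢r
    ; hub-unique = λ t~q t~r t~s t~p → hub-unique t~p t~q t~r t~s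
    }
    where open Wheel w

  reflect : ∀ {h p q r s} → Wheel h p q r s → Wheel h q p s r
  reflect w = record
    { h~p = h~q ; h~q = h~p ; h~r = h~s ; h~s = h~r
    ; p~q = ~-sym p~q ; q~r = ~-sym s~p ; r~s = ~-sym r~s ; s~p = ~-sym q~r
    ; p≁r = q≁s ; q≁s = p≁r ; p≢r = q≢s ; q≢s = p≢r
    ; hub-unique = λ t~q t~p t~s t~r → hub-unique t~p t~q t~r t~s
    }
    where open Wheel w

  record DiamondWheel : Set where
    field
      h p q r s    : Edge G
      wheel        : Wheel h p q r s
      triangle-hpq : NoCommonNeighbour h p q
      triangle-hrs : NoCommonNeighbour h r s
      star-hsp     : CommonNeighboursNear h s p
      star-hrq     : CommonNeighboursNear h r q
      h-nonPendant : ¬ Pendant G h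
      p-nonPendant : ¬ Pendant G p
      q-nonPendant : ¬ Pendant G q
      r-nonPendant : ¬ Pendant G r
      s-nonPendant : ¬ Pendant G s

  diamondWheel : HasInducedDiamond G → DiamondWheel
  diamondWheel (a , b , c , d , a≢d , ab , ac , bc , bd , cd , ad) =
    wheelOf (edgeOf ab) (edgeOf ac) (edgeOf bc) (edgeOf cd) (edgeOf bd)
    where
      a≢b : a ≢ b
      a≢b = adj⇒≢ ab
      a≢c : a ≢ c
      a≢c = adj⇒≢ ac
      b≢c : b ≢ c
      b≢c = adj⇒≢ bc
      b≢d : b ≢ d
      b≢d = adj⇒≢ bd
      c≢d : c ≢ d
      c≢d = adj⇒≢ cd
      deg-a : deg G a ≢ 1
      deg-a = deg≢1 ab ac b≢c
      deg-b : deg G b ≢ 1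
      deg-b = deg≢1 (adj-sym ab) bc a≢c
      deg-c : deg G c ≢ 1
      deg-c = deg≢1 (adj-sym ac) (adj-sym bc) a≢b
      deg-d : deg G d ≢ 1
      deg-d = deg≢1 (adj-sym bd) (adj-sym cd) b≢c
      EdgeBetween : Fin (n G) → Fin (n G) → Set
      EdgeBetween x y = Σ[ e ∈ Edge G ] (e ∋ x × e ∋ y)

      wheelOf : EdgeBetween a b → EdgeBetween a c → EdgeBetween b c → EdgeBetween c d →
        EdgeBetween b d → DiamondWheel
      wheelOf (p , pa , pb) (q , qa , qc) (h , hb , hc) (r , rc , rd) (s , sb , sd) = record
        { h = h ; p = p ; q = q ; r = r ; s = s
        ; wheel = record
          { h~p = shared⇒~ (≢-sym (∋∌⇒≢ᴱ pa h∌a)) hb pb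
          ; h~q = shared⇒~ (≢-sym (∋∌⇒≢ᴱ qa h∌a)) hc qc
          ; h~r = shared⇒~ (≢-sym (∋∌⇒≢ᴱ rd h∌d)) hc rc
          ; h~s = shared⇒~ (≢-sym (∋∌⇒≢ᴱ sd h∌d)) hb sb
          ; p~q = shared⇒~ (∋∌⇒≢ᴱ pb q∌b) pa qa
          ; q~r = shared⇒~ (∋∌⇒≢ᴱ qa r∌a) qc rc
          ; r~s = shared⇒~ (∋∌⇒≢ᴱ rc s∌c) rd sd
          ; s~p = shared⇒~ (∋∌⇒≢ᴱ sd p∌d) sb pb
          ; p≁r = apart⇒≁ pa pb a≢b r∌a r∌b
          ; q≁s = apart⇒≁ qa qc a≢c s∌a s∌c
          ; p≢r = ∋∌⇒≢ᴱ pa r∌a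
          ; q≢s = ∋∌⇒≢ᴱ qa s∌a
          ; hub-unique = hub-unique
          }
        ; triangle-hpq = triangle-noCommonNeighbour hb hc pa pb qa qc a≢b a≢c b≢c
        ; triangle-hrs =
            triangle-noCommonNeighbour hc hb rd rc sd sb (≢-sym c≢d) (≢-sym b≢d) (≢-sym b≢c)
        ; star-hsp = star-commonNeighboursNear hb sb sd pb pa b≢d (≢-sym a≢b) (≢-sym a≢d) da
        ; star-hrq = star-commonNeighboursNear hc rc rd qc qa c≢d (≢-sym a≢c) (≢-sym a≢d) da
        ; h-nonPendant = ¬Pendant hb hc b≢c deg-b deg-c
        ; p-nonPendant = ¬Pendant pa pb a≢b deg-a deg-b
        ; q-nonPendant = ¬Pendant qa qc a≢c deg-a deg-c
        ; r-nonPendant = ¬Pendant rc rd c≢d deg-c deg-d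
        ; s-nonPendant = ¬Pendant sb sd b≢d deg-b deg-d
        }
        where
          da : adj G d a ≡ false
          da = trans (symm G d a) ad
          h∌a : ¬ h ∋ a
          h∌a = ∌-pair hb hc b≢c a≢b a≢c
          h∌d : ¬ h ∋ d
          h∌d = ∌-pair hb hc b≢c (≢-sym b≢d) (≢-sym c≢d)
          q∌b : ¬ q ∋ b
          q∌b = ∌-pair qa qc a≢c (≢-sym a≢b) b≢c
          r∌a : ¬ r ∋ a
          r∌a = ∌-pair rc rd c≢d a≢c a≢d
          r∌b : ¬ r ∋ b
          r∌b = ∌-pair rc rd c≢d b≢c b≢d
          s∌a : ¬ s ∋ a
          s∌a = ∌-pair sb sd b≢d a≢b a≢d
          s∌c : ¬ s ∋ c
          s∌c = ∌-pair sb sd b≢d (≢-sym b≢c) c≢d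
          p∌d : ¬ p ∋ d
          p∌d = ∌-pair pa pb a≢b (≢-sym a≢d) (≢-sym b≢d)
          hub-unique : ∀ {t} → t ~ p → t ~ q → t ~ r → t ~ s → t ≡ h
          hub-unique t~p t~q t~r t~s with ~⇒shared t~p | ~⇒shared t~r
          ... | _ , tv , pv | _ , tw , rw with ∋-endpoints pa pb a≢b pv | ∋-endpoints rc rd c≢d rw
          ... | inj₁ refl | inj₁ refl = ⊥-elim (~⇒≢ t~q (edge-unique tv tw qa qc a≢c))
          ... | inj₁ refl | inj₂ refl = ⊥-elim (false⇒¬adj ad (∋⇒adj tv tw a≢d))
          ... | inj₂ refl | inj₁ refl = edge-unique tv tw hb hc b≢c
          ... | inj₂ refl | inj₂ refl = ⊥-elim (~⇒≢ t~s (edge-unique tv tw sb sd b≢d))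

  ∈P-irrelevant : ∀ {e} (P : Part (L G)) (m m′ : _∈P_ {L G} e P) → m ≡ m′
  ∈P-irrelevant (triangle _ _ _ _ _ _) (inj₁ refl) (inj₁ refl) = refl
  ∈P-irrelevant (triangle _ _ _ ab _ _) (inj₁ refl) (inj₂ (inj₁ e≡b)) = ⊥-elim (~⇒≢ ab e≡b)
  ∈P-irrelevant (triangle _ _ _ _ _ ac) (inj₁ refl) (inj₂ (inj₂ e≡c)) = ⊥-elim (~⇒≢ ac e≡c)
  ∈P-irrelevant (triangle _ _ _ ab _ _) (inj₂ (inj₁ refl)) (inj₁ e≡a) = ⊥-elim (~⇒≢ ab (sym e≡a))
  ∈P-irrelevant (triangle _ _ _ _ _ _) (inj₂ (inj₁ refl)) (inj₂ (inj₁ refl)) = refl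
  ∈P-irrelevant (triangle _ _ _ _ bc _) (inj₂ (inj₁ refl)) (inj₂ (inj₂ e≡c)) = ⊥-elim (~⇒≢ bc e≡c)
  ∈P-irrelevant (triangle _ _ _ _ _ ac) (inj₂ (inj₂ refl)) (inj₁ e≡a) = ⊥-elim (~⇒≢ ac (sym e≡a))
  ∈P-irrelevant (triangle _ _ _ _ bc _) (inj₂ (inj₂ refl)) (inj₂ (inj₁ e≡b)) =
    ⊥-elim (~⇒≢ bc (sym e≡b))
  ∈P-irrelevant (triangle _ _ _ _ _ _) (inj₂ (inj₂ refl)) (inj₂ (inj₂ refl)) = refl
  ∈P-irrelevant (edgePart _ _ _) (inj₁ refl) (inj₁ refl) = refl
  ∈P-irrelevant (edgePart _ _ ab) (inj₁ refl) (inj₂ e≡b) = ⊥-elim (~⇒≢ ab e≡b)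
  ∈P-irrelevant (edgePart _ _ ab) (inj₂ refl) (inj₁ e≡a) = ⊥-elim (~⇒≢ ab (sym e≡a))
  ∈P-irrelevant (edgePart _ _ _) (inj₂ refl) (inj₂ refl) = refl

  ∈P-adjacent : ∀ {e f} (P : Part (L G)) → _∈P_ {L G} e P → _∈P_ {L G} f P → e ≡ f ⊎ e ~ f
  ∈P-adjacent (triangle _ _ _ _  _  _ ) (inj₁ refl)        (inj₁ refl)        = inj₁ refl
  ∈P-adjacent (triangle _ _ _ ab _  _ ) (inj₁ refl)        (inj₂ (inj₁ refl)) = inj₂ ab
  ∈P-adjacent (triangle _ _ _ _  _  ac) (inj₁ refl)        (inj₂ (inj₂ refl)) = inj₂ ac
  ∈P-adjacent (triangle _ _ _ ab _  _ ) (inj₂ (inj₁ refl)) (inj₁ refl)        = inj₂ (~-sym ab)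
  ∈P-adjacent (triangle _ _ _ _  _  _ ) (inj₂ (inj₁ refl)) (inj₂ (inj₁ refl)) = inj₁ refl
  ∈P-adjacent (triangle _ _ _ _  bc _ ) (inj₂ (inj₁ refl)) (inj₂ (inj₂ refl)) = inj₂ bc
  ∈P-adjacent (triangle _ _ _ _  _  ac) (inj₂ (inj₂ refl)) (inj₁ refl)        = inj₂ (~-sym ac)
  ∈P-adjacent (triangle _ _ _ _  bc _ ) (inj₂ (inj₂ refl)) (inj₂ (inj₁ refl)) = inj₂ (~-sym bc)
  ∈P-adjacent (triangle _ _ _ _  _  _ ) (inj₂ (inj₂ refl)) (inj₂ (inj₂ refl)) = inj₁ refl
  ∈P-adjacent (edgePart _ _ _ ) (inj₁ refl) (inj₁ refl) = inj₁ refl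
  ∈P-adjacent (edgePart _ _ ab) (inj₁ refl) (inj₂ refl) = inj₂ ab
  ∈P-adjacent (edgePart _ _ ab) (inj₂ refl) (inj₁ refl) = inj₂ (~-sym ab)
  ∈P-adjacent (edgePart _ _ _ ) (inj₂ refl) (inj₂ refl) = inj₁ refl

  corner : Part (L G) → Fin 3 → Edge G
  corner (triangle a b c _ _ _) = lookup (a ∷ b ∷ c ∷ [])
  corner (edgePart a b _)       = lookup (a ∷ b ∷ b ∷ [])

  ∈P⇒corner : ∀ {e} (P : Part (L G)) → _∈P_ {L G} e P → Σ[ i ∈ Fin 3 ] (e ≡ corner P i)
  ∈P⇒corner (triangle _ _ _ _ _ _) (inj₁ e≡a)        = zero , e≡a
  ∈P⇒corner (triangle _ _ _ _ _ _) (inj₂ (inj₁ e≡b)) = suc zero , e≡b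
  ∈P⇒corner (triangle _ _ _ _ _ _) (inj₂ (inj₂ e≡c)) = suc (suc zero) , e≡c
  ∈P⇒corner (edgePart _ _ _)       (inj₁ e≡a)        = zero , e≡a
  ∈P⇒corner (edgePart _ _ _)       (inj₂ e≡b)        = suc zero , e≡b

  ∈P-atMostThree : (P : Part (L G)) → AtMostThree (λ e → _∈P_ {L G} e P)
  ∈P-atMostThree P = atMostThree-fromFin3 (proj₁ ∘ ∈P⇒corner P) λ me mf i≡j →
    trans (proj₂ (∈P⇒corner P me)) (trans (cong (corner P) i≡j) (sym (proj₂ (∈P⇒corner P mf))))

-- Valid decompositions of a line graph

Fin1-unique : (i j : Fin 1) → i ≡ j
Fin1-unique zero zero = refl

module Decomposed {F : FinGraph} {R : Edge F → Set} {D : Decomposition (L F)}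
                  (valid : IsValid (L F) R D) where

  open LineGraph F
    hiding (commonNeighbours-noIndependentTriple; commonNeighbours-complementaryPair; noTwoWings)
  open IsValid valid

  infix 4 _∈_ _⋈_

  _∈_ : Edge F → Fin (k D) → Set
  e ∈ i = _∈P_ {L F} e (part D i)

  _⋈_ : Fin (k D) → Fin (k D) → Set
  _⋈_ = Adj (I D)

  Disjoint : Fin (k D) → Fin (k D) → Set
  Disjoint i j = ∀ {t} → t ∈ i → t ∈ j → ⊥

  meet : ∀ {i j t} → i ≢ j → t ∈ i → t ∈ j → i ⋈ j
  meet i≢j ti tj = i≢j , _ , ti , tj

  ∈∉⇒≢ : ∀ {i j t} → t ∈ i → ¬ t ∈ j → i ≢ j
  ∈∉⇒≢ ti t∉j refl = t∉j ti

  Disjoint⇒≢ : ∀ {i j t} → Disjoint i j → t ∈ i → i ≢ j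
  Disjoint⇒≢ disjoint ti refl = disjoint ti ti

  Disjoint⇒⋪ : ∀ {i j} → Disjoint i j → ¬ i ⋈ j
  Disjoint⇒⋪ disjoint (_ , _ , ti , tj) = disjoint ti tj

  co-member : ∀ {i t e} → t ∈ i → e ∈ i → t ≡ e ⊎ t ~ e
  co-member {i} = ∈P-adjacent (part D i)

  co-member⇒~ : ∀ {i e f} → e ∈ i → f ∈ i → e ≢ f → e ~ f
  co-member⇒~ ei fi e≢f = [ ⊥-elim ∘ e≢f , id ]′ (co-member ei fi)

  nonadjacent⇒∉ : ∀ {i e f} → e ≢ f → ¬ e ~ f → e ∈ i → ¬ f ∈ i
  nonadjacent⇒∉ e≢f e≁f ei fi = e≁f (co-member⇒~ ei fi e≢f)

  apart⇒parts-≢ : ∀ {i j e f} → e ∈ i → f ∈ j → e ≢ f → ¬ e ~ f → i ≢ j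
  apart⇒parts-≢ ei fj e≢f e≁f refl = nonadjacent⇒∉ e≢f e≁f ei fj

  members-cover : ∀ {i a b c t} → a ∈ i → b ∈ i → c ∈ i → a ~ b → a ~ c → b ~ c → t ∈ i →
    t ≡ a ⊎ t ≡ b ⊎ t ≡ c
  members-cover {i} ai bi ci a~b a~c b~c =
    atMostThree-cover _≟ᴱ_ (∈P-atMostThree (part D i)) ai bi ci (~⇒≢ a~b) (~⇒≢ a~c) (~⇒≢ b~c)

  partOf : ∀ {e f} → e ~ f → Σ[ i ∈ Fin (k D) ] (e ∈ i × f ∈ i)
  partOf {e} {f} e~f = Inverse.from (partition e f e~f) zero

  partOf-unique : ∀ {e f i j} → e ~ f → e ∈ i → f ∈ i → e ∈ j → f ∈ j → i ≡ j
  partOf-unique {e} {f} {i} {j} e~f ei fi ej fj =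
    cong proj₁ (Injection.injective (↔⇒↣ (partition e f e~f))
      (Fin1-unique (to (i , ei , fi)) (to (j , ej , fj))))
    where open Inverse (partition e f e~f)

  module _ {e} (¬Re : ¬ R e) where

    parts-atMostThree : AtMostThree (e ∈_)
    parts-atMostThree = atMostThree-fromFin3 (λ ei → to (_ , ei))
      λ ei ej toᵢ≡toⱼ → cong proj₁ (Injection.injective (↔⇒↣ (nonroot e ¬Re)) toᵢ≡toⱼ)
      where open Inverse (nonroot e ¬Re)

    parts-cover : ∀ {i j l m} → e ∈ i → e ∈ j → e ∈ l → i ≢ j → i ≢ l → j ≢ l → e ∈ m →
      m ≡ i ⊎ m ≡ j ⊎ m ≡ l
    parts-cover = atMostThree-cover _≟_ parts-atMostThree

    thirdPart : ∀ {i j} → e ∈ i → e ∈ j → Σ[ l ∈ Fin (k D) ] (e ∈ l × l ≢ i × l ≢ j)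
    thirdPart = third-of-three (∈P-irrelevant (part D _)) (nonroot e ¬Re)

  ∉-members : ∀ {i a b c e} → (∀ {t} → t ∈ i → t ≡ a ⊎ t ≡ b ⊎ t ≡ c) →
    e ≢ a → e ≢ b → e ≢ c → ¬ e ∈ i
  ∉-members cover e≢a e≢b e≢c ei = [ e≢a , [ e≢b , e≢c ]′ ]′ (cover ei)

  ∉-by-partOf : ∀ {e f g i j} → e ~ f → e ∈ i → f ∈ i → f ∈ j → g ∈ j → ¬ g ∈ i → ¬ e ∈ j
  ∉-by-partOf e~f ei fi fj gj g∉i ej = g∉i (subst (_ ∈_) (partOf-unique e~f ej fj ei fi) gj)

  module _ {h p q r s} (w : Wheel h p q r s) where
    open Wheel w

    rimParts-disjoint : ∀ {U V} → p ∈ U → q ∈ U → ¬ h ∈ U → r ∈ V → s ∈ V → Disjoint U V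
    rimParts-disjoint {U} pU qU h∉U rV sV tU tV
      with co-member tU pU | co-member tU qU | co-member tV rV | co-member tV sV
    ... | inj₁ refl | _         | _         | _         = nonadjacent⇒∉ p≢r p≁r tV rV
    ... | _         | inj₁ refl | _         | _         = nonadjacent⇒∉ q≢s q≁s tV sV
    ... | _         | _         | inj₁ refl | _         = nonadjacent⇒∉ p≢r p≁r pU tU
    ... | _         | _         | _         | inj₁ refl = nonadjacent⇒∉ q≢s q≁s qU tU
    ... | inj₂ t~p  | inj₂ t~q  | inj₂ t~r  | inj₂ t~s  =
      h∉U (subst (_∈ U) (hub-unique t~p t~q t~r t~s) tU)

    hubNeighbour∈thirdPart : ∀ {X Y Z t} → ¬ R h →
      h ∈ X → p ∈ X → q ∈ X → h ∈ Y → r ∈ Y → s ∈ Y → X ≢ Y → h ∈ Z → Z ≢ X → Z ≢ Y →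
      t ~ h → t ~ p → t ~ s → t ∈ Z
    hubNeighbour∈thirdPart ¬Rh hX pX qX hY rY sY X≢Y hZ Z≢X Z≢Y t~h t~p t~s
      with partOf (~-sym t~h)
    ... | K , hK , tK with parts-cover ¬Rh hX hY hZ X≢Y (≢-sym Z≢X) (≢-sym Z≢Y) hK
    ... | inj₁ refl = ⊥-elim (∉-members (members-cover hX pX qX h~p h~q p~q)
                                (~⇒≢ t~h) (~⇒≢ t~p) (λ { refl → q≁s t~s }) tK)
    ... | inj₂ (inj₁ refl) = ⊥-elim (∉-members (members-cover hY rY sY h~r h~s r~s)
                                (~⇒≢ t~h) (λ { refl → p≁r (~-sym t~p) }) (~⇒≢ t~s) tK)
    ... | inj₂ (inj₂ refl) = tK

  module _ (lineGraphLike-I : LineGraphLike (I D)) where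
    open LineGraphLike lineGraphLike-I

    mixed-impossible : ∀ {h p q r s X Y Z} → Wheel h p q r s →
      h ∈ X → p ∈ X → q ∈ X → h ∈ Y → r ∈ Y → h ∈ Z → s ∈ Z → Y ≢ Z → ⊥
    mixed-impossible {h} {r = r} {s} {X} w hX pX qX hY rY hZ sZ Y≢Z
      with partOf (Wheel.r~s w) | partOf (Wheel.s~p w) | partOf (Wheel.q~r w)
    ... | W , rW , sW | P , sP , pP | Q , qQ , rQ =
      commonNeighbours-complementaryPair (Disjoint⇒≢ X-W-disjoint hX) (Disjoint⇒⋪ X-W-disjoint)
        (meet (∈∉⇒≢ rY r∉X) hY hX) (meet (∈∉⇒≢ hY h∉W) rY rW)
        (meet (∈∉⇒≢ sZ s∉X) hZ hX) (meet (∈∉⇒≢ hZ h∉W) sZ sW)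
        (meet (∈∉⇒≢ sP s∉X) pP pX) (meet (∈∉⇒≢ pP (X-W-disjoint pX)) sP sW)
        (meet (∈∉⇒≢ rQ r∉X) qQ qX) (meet (∈∉⇒≢ qQ (X-W-disjoint qX)) rQ rW)
        Y≢Z (∈∉⇒≢ hY h∉P) (∈∉⇒≢ hY h∉Q) (∈∉⇒≢ hZ h∉P) (∈∉⇒≢ hZ h∉Q)
        (Disjoint⇒≢ P-Q-disjoint sP) (Disjoint⇒⋪ P-Q-disjoint)
        (meet Y≢Z hY hZ)
      where
        open Wheel w
        r∉X : ¬ r ∈ X
        r∉X = nonadjacent⇒∉ p≢r p≁r pX
        s∉X : ¬ s ∈ X
        s∉X = nonadjacent⇒∉ q≢s q≁s qX
        h∉W : ¬ h ∈ W
        h∉W hW = Y≢Z (trans (partOf-unique h~r hY rY hW rW) (partOf-unique h~s hW sW hZ sZ))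
        X-W-disjoint : Disjoint X W
        X-W-disjoint tX tW with members-cover hX pX qX h~p h~q p~q tX
        ... | inj₁ refl        = h∉W tW
        ... | inj₂ (inj₁ refl) = nonadjacent⇒∉ p≢r p≁r tW rW
        ... | inj₂ (inj₂ refl) = nonadjacent⇒∉ q≢s q≁s tW sW
        h∉P : ¬ h ∈ P
        h∉P = ∉-by-partOf h~p hX pX pP sP s∉X
        h∉Q : ¬ h ∈ Q
        h∉Q = ∉-by-partOf h~q hX qX qQ rQ r∉X
        P-Q-disjoint : Disjoint P Q
        P-Q-disjoint = rimParts-disjoint (rotate (rotate (rotate w))) sP pP h∉P qQ rQ

    stars-impossible : ∀ {h p q r s X Y} → Wheel h p q r s →
      NoCommonNeighbour h p q → NoCommonNeighbour h r s → ¬ R h →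
      h ∈ X → p ∈ X → s ∈ X → h ∈ Y → q ∈ Y → r ∈ Y → X ≢ Y → ⊥
    stars-impossible {h} {p} {q} {r} {s} {X} {Y} w triangle-hpq triangle-hrs ¬Rh
      hX pX sX hY qY rY X≢Y
      with thirdPart ¬Rh hX hY | partOf (Wheel.p~q w) | partOf (Wheel.r~s w)
    ... | Z , hZ , Z≢X , Z≢Y | A , pA , qA | B , rB , sB =
      commonNeighbours-noIndependentTriple (meet X≢Y hX hY)
        (meet (∈∉⇒≢ qA q∉X) pA pX) (meet (∈∉⇒≢ pA p∉Y) qA qY)
        (meet (∈∉⇒≢ rB r∉X) sB sX) (meet (∈∉⇒≢ sB s∉Y) rB rY)
        (meet Z≢X hZ hX) (meet Z≢Y hZ hY)
        (Disjoint⇒≢ A-B-disjoint pA) (Disjoint⇒≢ A-Z-disjoint pA) (Disjoint⇒≢ B-Z-disjoint rB)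
        (Disjoint⇒⋪ A-B-disjoint) (Disjoint⇒⋪ A-Z-disjoint) (Disjoint⇒⋪ B-Z-disjoint)
      where
        open Wheel w
        q∉X : ¬ q ∈ X
        q∉X = nonadjacent⇒∉ (≢-sym q≢s) (q≁s ∘ ~-sym) sX
        r∉X : ¬ r ∈ X
        r∉X = nonadjacent⇒∉ p≢r p≁r pX
        p∉Y : ¬ p ∈ Y
        p∉Y = nonadjacent⇒∉ (≢-sym p≢r) (p≁r ∘ ~-sym) rY
        s∉Y : ¬ s ∈ Y
        s∉Y = nonadjacent⇒∉ q≢s q≁s qY
        h∉A : ¬ h ∈ A
        h∉A = ∉-by-partOf h~p hX pX pA qA q∉X
        h∉B : ¬ h ∈ B
        h∉B = ∉-by-partOf h~s hX sX sB rB r∉X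
        A-B-disjoint : Disjoint A B
        A-B-disjoint = rimParts-disjoint w pA qA h∉A rB sB
        A-Z-disjoint : Disjoint A Z
        A-Z-disjoint tA tZ with co-member tZ hZ | co-member tA pA | co-member tA qA
        ... | inj₁ refl | _         | _         = h∉A tA
        ... | _         | inj₁ refl | _         = Z≢X (partOf-unique h~p hZ tZ hX pX)
        ... | _         | _         | inj₁ refl = Z≢Y (partOf-unique h~q hZ tZ hY qY)
        ... | inj₂ t~h  | inj₂ t~p  | inj₂ t~q  = triangle-hpq t~h t~p t~q
        B-Z-disjoint : Disjoint B Z
        B-Z-disjoint tB tZ with co-member tZ hZ | co-member tB rB | co-member tB sB
        ... | inj₁ refl | _         | _         = h∉B tB
        ... | _         | inj₁ refl | _         = Z≢Y (partOf-unique h~r hZ tZ hY rY)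
        ... | _         | _         | inj₁ refl = Z≢X (partOf-unique h~s hZ tZ hX sX)
        ... | inj₂ t~h  | inj₂ t~r  | inj₂ t~s  = triangle-hrs t~h t~r t~s

    wing : ∀ {h p q r s X Y Z U} → Wheel h p q r s → CommonNeighboursNear h s p →
      ¬ R h → ¬ R p → ¬ R s →
      h ∈ X → p ∈ X → q ∈ X → h ∈ Y → r ∈ Y → s ∈ Y → X ≢ Y →
      h ∈ Z → Z ≢ X → Z ≢ Y → s ∈ U → p ∈ U → Wing (I D) X Y Z U
    wing {h} {p} {q} {r} {s} {X} {Y} {Z} w star-hsp ¬Rh ¬Rp ¬Rs
      hX pX qX hY rY sY X≢Y hZ Z≢X Z≢Y sU pU
      with thirdPart ¬Rp pX pU | thirdPart ¬Rs sY sU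
    ... | U₂ , pU₂ , U₂≢X , U₂≢U | U₃ , sU₃ , U₃≢Y , U₃≢U = record
      { U₂ = U₂ ; U₃ = U₃
      ; U₂~X = meet U₂≢X pU₂ pX
      ; U₂~U = meet U₂≢U pU₂ pU
      ; U₂≁Y = Disjoint⇒⋪ U₂-Y-disjoint
      ; U₂≢Y = Disjoint⇒≢ U₂-Y-disjoint pU₂
      ; U₃~U = meet U₃≢U sU₃ sU
      ; U₃≁X = Disjoint⇒⋪ U₃-X-disjoint
      ; U₃≢X = Disjoint⇒≢ U₃-X-disjoint sU₃
      ; closes = λ { (_ , _ , tU₂ , tU₃) → meet (∈∉⇒≢ hZ h∉U₂) (common∈Z tU₂ tU₃) tU₂ }
      }
      where
        open Wheel w
        X-members : ∀ {t} → t ∈ X → t ≡ h ⊎ t ≡ p ⊎ t ≡ q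
        X-members = members-cover hX pX qX h~p h~q p~q
        Y-members : ∀ {t} → t ∈ Y → t ≡ h ⊎ t ≡ r ⊎ t ≡ s
        Y-members = members-cover hY rY sY h~r h~s r~s
        h∉U₂ : ¬ h ∈ U₂
        h∉U₂ hU₂ = U₂≢X (partOf-unique h~p hU₂ pU₂ hX pX)
        U₂-Y-disjoint : Disjoint U₂ Y
        U₂-Y-disjoint tU₂ tY with Y-members tY
        ... | inj₁ refl        = h∉U₂ tU₂
        ... | inj₂ (inj₁ refl) = nonadjacent⇒∉ p≢r p≁r pU₂ tU₂
        ... | inj₂ (inj₂ refl) = U₂≢U (partOf-unique s~p tU₂ pU₂ sU pU)
        U₃-X-disjoint : Disjoint U₃ X
        U₃-X-disjoint tU₃ tX with X-members tX
        ... | inj₁ refl        = U₃≢Y (partOf-unique h~s tU₃ sU₃ hY sY)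
        ... | inj₂ (inj₁ refl) = U₃≢U (partOf-unique s~p sU₃ tU₃ sU pU)
        ... | inj₂ (inj₂ refl) = nonadjacent⇒∉ q≢s q≁s tU₃ sU₃
        common∈Z : ∀ {t} → t ∈ U₂ → t ∈ U₃ → t ∈ Z
        common∈Z tU₂ tU₃ with co-member tU₂ pU₂ | co-member tU₃ sU₃
        ... | inj₁ refl | _         = ⊥-elim (U₃≢U (partOf-unique s~p sU₃ tU₃ sU pU))
        ... | _         | inj₁ refl = ⊥-elim (U₂≢U (partOf-unique s~p tU₂ pU₂ sU pU))
        ... | inj₂ t~p  | inj₂ t~s with star-hsp t~s t~p
        ...   | inj₁ refl = ⊥-elim (h∉U₂ tU₂)
        ...   | inj₂ t~h  =
          hubNeighbour∈thirdPart w ¬Rh hX pX qX hY rY sY X≢Y hZ Z≢X Z≢Y t~h t~p t~s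

    triangles-impossible : ∀ {h p q r s X Y} → Wheel h p q r s →
      CommonNeighboursNear h s p → CommonNeighboursNear h r q →
      ¬ R h → ¬ R p → ¬ R q → ¬ R r → ¬ R s →
      h ∈ X → p ∈ X → q ∈ X → h ∈ Y → r ∈ Y → s ∈ Y → X ≢ Y → ⊥
    triangles-impossible {h} {p} {q} {r} {s} {X} {Y} w star-hsp star-hrq ¬Rh ¬Rp ¬Rq ¬Rr ¬Rs
      hX pX qX hY rY sY X≢Y
      with thirdPart ¬Rh hX hY | partOf (Wheel.s~p w) | partOf (Wheel.q~r w)
    ... | Z , hZ , Z≢X , Z≢Y | P , sP , pP | Q , qQ , rQ =
      noTwoWings (meet X≢Y hX hY)
        (meet (∈∉⇒≢ sP s∉X) pP pX) (meet (∈∉⇒≢ pP p∉Y) sP sY)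
        (meet (∈∉⇒≢ rQ r∉X) qQ qX) (meet (∈∉⇒≢ qQ q∉Y) rQ rY)
        (Disjoint⇒≢ P-Q-disjoint sP) (Disjoint⇒⋪ P-Q-disjoint)
        (meet Z≢X hZ hX) (meet Z≢Y hZ hY) (∈∉⇒≢ hZ h∉P) (∈∉⇒≢ hZ h∉Q)
        (wing w star-hsp ¬Rh ¬Rp ¬Rs hX pX qX hY rY sY X≢Y hZ Z≢X Z≢Y sP pP)
        (wing (reflect w) star-hrq ¬Rh ¬Rq ¬Rr hX qX pX hY sY rY X≢Y hZ Z≢X Z≢Y rQ qQ)
      where
        open Wheel w
        r∉X : ¬ r ∈ X
        r∉X = nonadjacent⇒∉ p≢r p≁r pX
        s∉X : ¬ s ∈ X
        s∉X = nonadjacent⇒∉ q≢s q≁s qX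
        p∉Y : ¬ p ∈ Y
        p∉Y = nonadjacent⇒∉ (≢-sym p≢r) (p≁r ∘ ~-sym) rY
        q∉Y : ¬ q ∈ Y
        q∉Y = nonadjacent⇒∉ (≢-sym q≢s) (q≁s ∘ ~-sym) sY
        h∉P : ¬ h ∈ P
        h∉P = ∉-by-partOf h~p hX pX pP sP s∉X
        h∉Q : ¬ h ∈ Q
        h∉Q = ∉-by-partOf h~q hX qX qQ rQ r∉X
        P-Q-disjoint : Disjoint P Q
        P-Q-disjoint = rimParts-disjoint (rotate (rotate (rotate w))) sP pP h∉P qQ rQ

    wheel-impossible : ∀ {h p q r s} → Wheel h p q r s →
      NoCommonNeighbour h p q → NoCommonNeighbour h r s →
      CommonNeighboursNear h s p → CommonNeighboursNear h r q →
      ¬ R h → ¬ R p → ¬ R q → ¬ R r → ¬ R s → ⊥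
    wheel-impossible w triangle-hpq triangle-hrs star-hsp star-hrq ¬Rh ¬Rp ¬Rq ¬Rr ¬Rs
      with partOf (Wheel.h~p w) | partOf (Wheel.h~q w) | partOf (Wheel.h~r w) | partOf (Wheel.h~s w)
    ... | Πp , hΠp , pΠp | Πq , hΠq , qΠq | Πr , hΠr , rΠr | Πs , hΠs , sΠs
      with Πp ≟ Πq | Πr ≟ Πs | Πq ≟ Πr | Πs ≟ Πp
    ... | yes refl | yes refl | _        | _        =
      triangles-impossible w star-hsp star-hrq ¬Rh ¬Rp ¬Rq ¬Rr ¬Rs hΠp pΠp qΠq hΠr rΠr sΠs
        (apart⇒parts-≢ pΠp rΠr (Wheel.p≢r w) (Wheel.p≁r w))
    ... | yes refl | no Πr≢Πs | _        | _        =
      mixed-impossible w hΠp pΠp qΠq hΠr rΠr hΠs sΠs Πr≢Πs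
    ... | no Πp≢Πq | yes refl | _        | _        =
      mixed-impossible (rotate (rotate w)) hΠr rΠr sΠs hΠp pΠp hΠq qΠq Πp≢Πq
    ... | no Πp≢Πq | no _     | yes refl | yes refl =
      stars-impossible w triangle-hpq triangle-hrs ¬Rh hΠp pΠp sΠs hΠq qΠq rΠr Πp≢Πq
    ... | no _     | no _     | yes refl | no Πs≢Πp =
      mixed-impossible (rotate w) hΠq qΠq rΠr hΠs sΠs hΠp pΠp Πs≢Πp
    ... | no _     | no _     | no Πq≢Πr | yes refl =
      mixed-impossible (rotate (rotate (rotate w))) hΠs sΠs pΠp hΠq qΠq hΠr rΠr Πq≢Πr
    ... | no Πp≢Πq | no Πr≢Πs | no Πq≢Πr | no Πs≢Πp =
      parts-atMostThree ¬Rh hΠp hΠq hΠr hΠs Πp≢Πq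
        (apart⇒parts-≢ pΠp rΠr (Wheel.p≢r w) (Wheel.p≁r w)) (≢-sym Πs≢Πp) Πq≢Πr
        (apart⇒parts-≢ qΠq sΠs (Wheel.q≢s w) (Wheel.q≁s w)) Πr≢Πs

lemma4p10 : (F : FinGraph) (R : Edge F → Set) → (∀ e → R e → Pendant F e) →
    (D : Decomposition (L F)) → IsValid (L F) R D →
    (Σ[ F' ∈ FinGraph ] Σ[ ψ ∈ Iso (I D) (L F') ]
      (∀ i → IsEdgePart (part D i) → Pendant F' (Inverse.to (φ ψ) i))) →
    ¬ HasInducedDiamond F
lemma4p10 F R roots-pendant D valid (F′ , ψ , _) diamond =
  wheel-impossible (LineGraphLike-transport ψ (LineGraph.lineGraphLike F′))
    wheel triangle-hpq triangle-hrs star-hsp star-hrq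
    (nonroot h-nonPendant) (nonroot p-nonPendant) (nonroot q-nonPendant)
    (nonroot r-nonPendant) (nonroot s-nonPendant)
  where
    open Decomposed valid
    open LineGraph.DiamondWheel (LineGraph.diamondWheel F diamond)
    nonroot : ∀ {e} → ¬ Pendant F e → ¬ R e
    nonroot ¬pendant = ¬pendant ∘ roots-pendant _
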